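{- Let $G$ be a trivially perfect graph with cotree $T$ in which every $1$-node has at most one child that is not a leaf, and let $\mathcal{C}$ be a well-behaved clustering of $G$. Let $u\in V(T)$ with clade $X=L(u)$, and let $k_u^*=\max_{C_j\in\mathcal{C}}|X\cap C_j|$. Then $\mathcal{C}|_X=\{C\cap X: C\in\mathcal{C}\}\setminus\{\emptyset\}$ is a clustering of $G[X]$ whose cost $cost_{G[X]}(\mathcal{C}|_X)$ is minimum among all clusterings of $G[X]$ whose largest cluster has size $k_u^*$.
   Context: A cotree of a graph $G$ is a rooted tree $T$ whose leaf set is $V(G)$ and whose internal nodes are $0$-nodes or $1$-nodes, such that $uv\in E(G)$ iff the lowest common ancestor of $u,v$ is a $1$-node. A trivially perfect graph is a $\{P_4,C_4\}$-free graph; equivalently, one admitting a cotree in which every $1$-node has at most one non-leaf child. For $v\in V(T)$, the clade $L(v)$ is the set of leaves descending from $v$. A clustering of a graph $H$ is a partition of $V(H)$; its cost $cost_H(\cdot)$ is the number of edges between different parts plus the number of non-adjacent pairs within a common part; an optimal clustering has minimum cost. A clade $X$ grows in a cluster $C$ if $C\cap X\ne\emptyset$ and $C\setminus X\ne\emptyset$; $X$ has a single-growth in $\mathcal{C}$ if it grows in at most one cluster of $\mathcal{C}$. A clustering $\mathcal{C}$ of $G$ is well-behaved if it is optimal, every clade of $T$ has a single-growth in $\mathcal{C}$, and $|\mathcal{C}|$ is maximum among all optimal clusterings with this property. -}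

module Defs where

open import Data.Nat using (ℕ; zero; suc; _+_; _≤_; _⊔_)
open import Data.Nat.Properties using () renaming (_≟_ to _≟ℕ_)
open import Data.Bool using (Bool; true; false; not; _∧_; _∨_; if_then_else_)
open import Data.Fin using (Fin)
open import Data.List using (List; []; _∷_; length; filter; map; foldr; _++_; lookup; deduplicate; allFin)
open import Data.List.Membership.Propositional using (_∈_; _∉_)
open import Data.List.Relation.Binary.Permutation.Propositional using (_↭_)
open import Data.Product using (Σ; ∃; _×_; _,_)
open import Relation.Binary.PropositionalEquality using (_≡_; _≢_)
open import Relation.Nullary using (¬_; does)
open import Function.Bundles using (_⇔_)

record Graph (n : ℕ) : Set where
  field
    adj   : Fin n → Fin n → Bool
    sym   : ∀ u v → adj u v ≡ adj v u
    irrefl : ∀ u → adj u u ≡ false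
open Graph public

-- Cotrees: rooted trees whose leaves are vertices and whose internal
-- nodes carry a label (true = 1-node, false = 0-node).

data Cotree (n : ℕ) : Set where
  leaf : Fin n → Cotree n
  node : Bool → List (Cotree n) → Cotree n

mutual
  leaves : ∀ {n} → Cotree n → List (Fin n)
  leaves (leaf v)    = v ∷ []
  leaves (node _ cs) = leavesL cs

  leavesL : ∀ {n} → List (Cotree n) → List (Fin n)
  leavesL []       = []
  leavesL (c ∷ cs) = leaves c ++ leavesL cs

-- s ⊑ t : s is a node (subtree) of t ; the nodes of T are the s with s ⊑ T
data _⊑_ {n : ℕ} : Cotree n → Cotree n → Set where
  ⊑-refl  : ∀ {s} → s ⊑ s
  ⊑-child : ∀ {s c b cs} → c ∈ cs → s ⊑ c → s ⊑ node b cs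

data Lca {n : ℕ} : Cotree n → Fin n → Fin n → Bool → Set where
  here  : ∀ {b cs u v} (i j : Fin (length cs)) → i ≢ j →
          u ∈ leaves (lookup cs i) → v ∈ leaves (lookup cs j) →
          Lca (node b cs) u v b
  there : ∀ {b b' cs c u v} → c ∈ cs → Lca c u v b' → Lca (node b cs) u v b'

IsLeaf : ∀ {n} → Cotree n → Set
IsLeaf t = ∃ λ v → t ≡ leaf v

IsCotree : ∀ {n} → Graph n → Cotree n → Set
IsCotree {n} G T =
  (leaves T ↭ allFin n) ×
  (∀ u v → u ≢ v → ((adj G u v ≡ true) ⇔ Lca T u v true))

OneNodesHaveOneNonLeafChild : ∀ {n} → Cotree n → Set
OneNodesHaveOneNonLeafChild T =
  ∀ cs → node true cs ⊑ T →
  ∀ (i j : Fin (length cs)) → ¬ IsLeaf (lookup cs i) → ¬ IsLeaf (lookup cs j) → i ≡ j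

-- A clustering (partition) of a vertex set X (given as a
-- duplicate-free list) is represented by a labelling f : Fin n → ℕ; the
-- clusters are the nonempty fibres f⁻¹(c) ∩ X. Values off X are ignored.

Labelling : ℕ → Set
Labelling n = Fin n → ℕ

bad : ∀ {n} → Graph n → Labelling n → Fin n → Fin n → ℕ
bad G f u v with adj G u v | does (f u ≟ℕ f v)
... | true  | false = 1
... | false | true  = 1
... | _     | _     = 0

cost : ∀ {n} → Graph n → List (Fin n) → Labelling n → ℕ
cost G []       f = 0
cost G (x ∷ xs) f = foldr _+_ 0 (map (bad G f x) xs) + cost G xs f

clusterSize : ∀ {n} → List (Fin n) → Labelling n → ℕ → ℕ
clusterSize X f c = length (filter (λ w → f w ≟ℕ c) X)

maxClusterSize : ∀ {n} → List (Fin n) → Labelling n → ℕ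
maxClusterSize X f = foldr _⊔_ 0 (map (λ v → clusterSize X f (f v)) X)

numClusters : ∀ {n} → Labelling n → ℕ
numClusters {n} f = length (deduplicate _≟ℕ_ (map f (allFin n)))

Optimal : ∀ {n} → Graph n → Labelling n → Set
Optimal {n} G f = ∀ (g : Labelling n) → cost G (allFin n) f ≤ cost G (allFin n) g

Grows : ∀ {n} → List (Fin n) → Labelling n → ℕ → Set
Grows X f c = (∃ λ v → v ∈ X × f v ≡ c) × (∃ λ w → w ∉ X × f w ≡ c)

SingleGrowth : ∀ {n} → List (Fin n) → Labelling n → Set
SingleGrowth X f = ∀ c c' → Grows X f c → Grows X f c' → c ≡ c'

AllCladesSingleGrowth : ∀ {n} → Cotree n → Labelling n → Set
AllCladesSingleGrowth T f = ∀ s → s ⊑ T → SingleGrowth (leaves s) f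

WellBehaved : ∀ {n} → Graph n → Cotree n → Labelling n → Set
WellBehaved G T f =
  Optimal G f × AllCladesSingleGrowth T f ×
  (∀ g → Optimal G g → AllCladesSingleGrowth T g → numClusters g ≤ numClusters f)

{-# OPTIONS --safe #-}
module Submission where

-- A clade X = L(u) is a module of G: every vertex outside X is adjacent to all of X or to none of it.
-- Let f be optimal with X growing only into the cluster c₀, put s = |X ∩ c₀|, and let g be a
-- clustering of X with a cluster ℓ of size k ≥ s. Glue g on X to f outside X in two ways: keeping
-- the clusters of g apart from those of f, or merging ℓ into c₀. Both gluings cost
-- cost_{V∖X}(f) + cost_X(g) + (crossing cost). As X is a module, a clustering whose cluster c₀ meets
-- X in m vertices has crossing cost Q + m(β − α) for a constant Q, where α and β count the vertices
-- of c₀ ∖ X adjacent resp. non-adjacent to X. This is affine in m ∈ {0, s, k}, so one gluing crosses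
-- no more than f does, and optimality of f yields cost_X(f) ≤ cost_X(g).

open import Defs
open import Data.Nat using (ℕ; suc; _+_; _*_; _≤_; _⊔_; z≤n)
open import Data.Nat.Properties
  using (_≟_; +-identityʳ; +-suc; +-assoc; *-identityʳ; *-zeroʳ; *-distribˡ-+; *-cancelˡ-≡; *-monoʳ-≤;
         +-monoʳ-≤; +-cancelʳ-≤; +-cancelˡ-≤; ≤-trans; ≤-reflexive; ≤-total; m≤m+n; m≤m⊔n; m≤n⇒m≤o⊔n;
         m≤n⇒∃[o]m+o≡n; ⊔-sel; suc-injective; even≢odd; +-commutativeSemigroup; module ≤-Reasoning)
open import Data.Nat.ListAction using (sum)
open import Data.Nat.ListAction.Properties using (sum-++; sum-↭)
open import Data.Nat.Tactic.RingSolver using (solve-∀)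
open import Algebra.Properties.CommutativeSemigroup +-commutativeSemigroup using (interchange; xy∙z≈xz∙y)
open import Data.Bool using (true; false; if_then_else_)
open import Data.Bool.Properties using (⇔→≡)
open import Data.Fin using (Fin)
import Data.Fin.Properties as Fin
open import Data.List using (List; []; _∷_; _++_; length; filter; map; foldr; allFin)
open import Data.List.Properties using (map-++; map-cong-local; filter-none; ++-assoc)
open import Data.List.Membership.Propositional using (_∈_; _∉_; find; lose)
open import Data.List.Membership.Propositional.Properties
  using (∈-++⁺ˡ; ∈-++⁺ʳ; ∈-map⁺; ∈-map⁻; ∈-allFin; ∈-lookup; foldr-selective)
open import Data.List.Relation.Unary.All as All using (All; []; _∷_)
open import Data.List.Relation.Unary.All.Properties using (++⁻ˡ; ++⁻ʳ)
open import Data.List.Relation.Unary.Any using (here; there; any?)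
open import Data.List.Relation.Unary.Unique.Propositional using (Unique; []; _∷_)
open import Data.List.Relation.Unary.Unique.Propositional.Properties using (allFin⁺)
open import Data.List.Relation.Binary.Disjoint.Propositional using (Disjoint)
open import Data.List.Relation.Binary.Permutation.Propositional
  using (_↭_; refl; prep; swap; trans; ↭-refl; ↭-sym; ↭-trans; ↭-reflexive; ↭⇒↭ₛ)
open import Data.List.Relation.Binary.Permutation.Propositional.Properties using (map⁺; ++-comm; ++⁺ˡ)
import Data.List.Relation.Binary.Permutation.Setoid.Properties as Permutationₛ
open import Data.Product using (∃; ∃-syntax; _×_; _,_; proj₁; proj₂)
open import Data.Sum using (_⊎_; inj₁; inj₂)
open import Function using (_∘_; _⇔_; mk⇔; Injective; Equivalence)
open import Level using (0ℓ)
open import Relation.Nullary using (yes; no; does; contradiction; ¬?; _×-dec_)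
open import Relation.Nullary.Decidable using (does-⇔; dec-true; dec-false)
open import Relation.Unary using (Pred; Decidable)
open import Relation.Binary.PropositionalEquality as ≡ using (_≡_; _≢_; refl; cong; cong₂; subst; module ≡-Reasoning)

module _ {n : ℕ} where
  open import Data.List.Membership.DecPropositional (Fin._≟_ {n}) public using (_∈?_)

rearrangement : ∀ {s k β α} → s ≤ k → β ≤ α → s * α + k * β ≤ k * α + s * β
rearrangement {s} {β = β} s≤k β≤α with m≤n⇒∃[o]m+o≡n s≤k | m≤n⇒∃[o]m+o≡n β≤α
... | d , refl | e , refl = begin
  s * (β + e) + (s + d) * β          ≤⟨ m≤m+n _ (d * e) ⟩
  s * (β + e) + (s + d) * β + d * e  ≡⟨ identity s d β e ⟩
  (s + d) * (β + e) + s * β          ∎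
  where
  open ≤-Reasoning
  identity : ∀ s d β e → s * (β + e) + (s + d) * β + d * e ≡ (s + d) * (β + e) + s * β
  identity = solve-∀

affine-min : ∀ {α β Q C₀ Cₛ Cₖ s k} → C₀ ≡ Q → Cₛ + s * α ≡ Q + s * β → Cₖ + k * α ≡ Q + k * β →
             s ≤ k → Cₖ ≤ Cₛ ⊎ C₀ ≤ Cₛ
affine-min {α} {β} {Q} {C₀} {Cₛ} {Cₖ} {s} {k} refl eₛ eₖ s≤k with ≤-total β α
... | inj₁ β≤α = inj₁ (+-cancelʳ-≤ (s * α + k * β) Cₖ Cₛ (begin
  Cₖ + (s * α + k * β)  ≤⟨ +-monoʳ-≤ Cₖ (rearrangement s≤k β≤α) ⟩
  Cₖ + (k * α + s * β)  ≡⟨ +-assoc Cₖ _ _ ⟨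
  Cₖ + k * α + s * β    ≡⟨ cong (_+ s * β) eₖ ⟩
  Q + k * β + s * β     ≡⟨ xy∙z≈xz∙y Q _ _ ⟩
  Q + s * β + k * β     ≡⟨ cong (_+ k * β) eₛ ⟨
  Cₛ + s * α + k * β    ≡⟨ +-assoc Cₛ _ _ ⟩
  Cₛ + (s * α + k * β)  ∎))
  where open ≤-Reasoning
... | inj₂ α≤β = inj₂ (+-cancelʳ-≤ (s * α) Q Cₛ (begin
  Q + s * α   ≤⟨ +-monoʳ-≤ Q (*-monoʳ-≤ s α≤β) ⟩
  Q + s * β   ≡⟨ eₛ ⟨
  Cₛ + s * α  ∎))
  where open ≤-Reasoning

sum-affine : ∀ {A : Set} (F a Q b : A → ℕ) m xs →
             (∀ {x} → x ∈ xs → F x + m * a x ≡ Q x + m * b x) →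
             sum (map F xs) + m * sum (map a xs) ≡ sum (map Q xs) + m * sum (map b xs)
sum-affine F a Q b m [] _ = refl
sum-affine F a Q b m (x ∷ xs) e = begin
  (F x + ΣF) + m * (a x + Σa)      ≡⟨ cong ((F x + ΣF) +_) (*-distribˡ-+ m (a x) Σa) ⟩
  (F x + ΣF) + (m * a x + m * Σa)  ≡⟨ interchange (F x) ΣF _ _ ⟩
  (F x + m * a x) + (ΣF + m * Σa)  ≡⟨ cong₂ _+_ (e (here refl)) (sum-affine F a Q b m xs (e ∘ there)) ⟩
  (Q x + m * b x) + (ΣQ + m * Σb)  ≡⟨ interchange (Q x) _ ΣQ _ ⟩
  (Q x + ΣQ) + (m * b x + m * Σb)  ≡⟨ cong ((Q x + ΣQ) +_) (*-distribˡ-+ m (b x) Σb) ⟨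
  (Q x + ΣQ) + m * (b x + Σb)      ∎
  where
  open ≡-Reasoning
  ΣF = sum (map F xs)
  Σa = sum (map a xs)
  ΣQ = sum (map Q xs)
  Σb = sum (map b xs)

≤-foldr-⊔ : ∀ {m ns} → m ∈ ns → m ≤ foldr _⊔_ 0 ns
≤-foldr-⊔ (here refl)  = m≤m⊔n _ _
≤-foldr-⊔ (there m∈ns) = m≤n⇒m≤o⊔n _ (≤-foldr-⊔ m∈ns)

length-filter-cong : ∀ {A : Set} {P Q : Pred A 0ℓ} (P? : Decidable P) (Q? : Decidable Q) xs →
                     (∀ {x} → x ∈ xs → P x ⇔ Q x) → length (filter P? xs) ≡ length (filter Q? xs)
length-filter-cong P? Q? [] _ = refl
length-filter-cong P? Q? (x ∷ xs) P⇔Q with P? x | Q? x | length-filter-cong P? Q? xs (P⇔Q ∘ there)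
... | yes _ | yes _ | eq = cong suc eq
... | no _  | no _  | eq = eq
... | yes p | no ¬q | _  = contradiction (Equivalence.to (P⇔Q (here refl)) p) ¬q
... | no ¬p | yes q | _  = contradiction (Equivalence.from (P⇔Q (here refl)) q) ¬p

Unique-↭ : ∀ {A : Set} {xs ys : List A} → xs ↭ ys → Unique xs → Unique ys
Unique-↭ {A} p = Permutationₛ.Unique-resp-↭ (≡.setoid A) (↭⇒↭ₛ p)

Unique-++⁻ : ∀ {A : Set} (xs : List A) {ys} → Unique (xs ++ ys) → Unique xs × Unique ys × Disjoint xs ys
Unique-++⁻ [] ys! = [] , ys! , λ ()
Unique-++⁻ (x ∷ xs) (x∉xs++ys ∷ xs++ys!) with Unique-++⁻ xs xs++ys!
... | xs! , ys! , xs#ys = ++⁻ˡ xs x∉xs++ys ∷ xs! , ys! , λ where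
  (here refl , v∈ys)  → All.lookup (++⁻ʳ xs x∉xs++ys) v∈ys refl
  (there v∈xs , v∈ys) → xs#ys (v∈xs , v∈ys)

∈-leavesL : ∀ {n} {c : Cotree n} {cs y} → c ∈ cs → y ∈ leaves c → y ∈ leavesL cs
∈-leavesL              (here refl)  y∈c = ∈-++⁺ˡ y∈c
∈-leavesL {cs = d ∷ _} (there c∈cs) y∈c = ∈-++⁺ʳ (leaves d) (∈-leavesL c∈cs y∈c)

leaves-⊑ : ∀ {n} {u t : Cotree n} {y} → u ⊑ t → y ∈ leaves u → y ∈ leaves t
leaves-⊑ ⊑-refl             y∈u = y∈u
leaves-⊑ (⊑-child c∈cs u⊑c) y∈u = ∈-leavesL c∈cs (leaves-⊑ u⊑c y∈u)

Lca⇒∈leaves : ∀ {n} {t : Cotree n} {w x b} → Lca t w x b → w ∈ leaves t × x ∈ leaves t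
Lca⇒∈leaves (here {cs = cs} i j _ w∈i x∈j) =
  ∈-leavesL (∈-lookup {xs = cs} i) w∈i , ∈-leavesL (∈-lookup {xs = cs} j) x∈j
Lca⇒∈leaves (there c∈cs lca) = let w∈c , x∈c = Lca⇒∈leaves lca in ∈-leavesL c∈cs w∈c , ∈-leavesL c∈cs x∈c

Unique-child : ∀ {n} {cs : List (Cotree n)} {c} → Unique (leavesL cs) → c ∈ cs → Unique (leaves c)
Unique-child {cs = d ∷ _} cs! (here refl)  = proj₁ (Unique-++⁻ (leaves d) cs!)
Unique-child {cs = d ∷ _} cs! (there c∈cs) = Unique-child (proj₁ (proj₂ (Unique-++⁻ (leaves d) cs!))) c∈cs

same-child : ∀ {n} {cs : List (Cotree n)} {c c' y} → Unique (leavesL cs) → c ∈ cs → c' ∈ cs →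
             y ∈ leaves c → y ∈ leaves c' → c ≡ c'
same-child _ (here refl) (here refl) _ _ = refl
same-child {cs = d ∷ _} cs! (here refl) (there c'∈cs) y∈c y∈c' =
  contradiction (y∈c , ∈-leavesL c'∈cs y∈c') (proj₂ (proj₂ (Unique-++⁻ (leaves d) cs!)))
same-child {cs = d ∷ _} cs! (there c∈cs) (here refl) y∈c y∈c' =
  contradiction (y∈c' , ∈-leavesL c∈cs y∈c) (proj₂ (proj₂ (Unique-++⁻ (leaves d) cs!)))
same-child {cs = d ∷ _} cs! (there c∈cs) (there c'∈cs) =
  same-child (proj₁ (proj₂ (Unique-++⁻ (leaves d) cs!))) c∈cs c'∈cs

Lca-clade : ∀ {n} {u t : Cotree n} {w x x' b} → u ⊑ t → Unique (leaves t) →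
            w ∉ leaves u → x ∈ leaves u → x' ∈ leaves u → Lca t w x b → Lca t w x' b
Lca-clade ⊑-refl _ w∉u _ _ lca = contradiction (proj₁ (Lca⇒∈leaves lca)) w∉u
Lca-clade {x' = x'} (⊑-child {cs = cs} c∈cs u⊑c) t! _ x∈u x'∈u (here i j i≢j w∈i x∈j) =
  here i j i≢j w∈i (subst (λ c → x' ∈ leaves c) c≡j (leaves-⊑ u⊑c x'∈u))
  where
  c≡j = same-child t! c∈cs (∈-lookup j) (leaves-⊑ u⊑c x∈u) x∈j
Lca-clade (⊑-child c∈cs u⊑c) t! w∉u x∈u x'∈u (there c'∈cs lca) =
  there c∈cs (Lca-clade u⊑c (Unique-child t! c∈cs) w∉u x∈u x'∈u (subst (λ c → Lca c _ _ _) c'≡c lca))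
  where
  c'≡c = same-child t! c'∈cs c∈cs (proj₂ (Lca⇒∈leaves lca)) (leaves-⊑ u⊑c x∈u)

split-child : ∀ {n} {cs : List (Cotree n)} {c} → c ∈ cs → ∃[ R ] leavesL cs ↭ R ++ leaves c
split-child {cs = c ∷ cs} (here refl) = leavesL cs , ++-comm (leaves c) (leavesL cs)
split-child {cs = d ∷ _} (there c∈cs) =
  let R , cs↭R++c = split-child c∈cs
  in leaves d ++ R , ↭-trans (++⁺ˡ (leaves d) cs↭R++c) (↭-reflexive (≡.sym (++-assoc (leaves d) R _)))

split-⊑ : ∀ {n} {u t : Cotree n} → u ⊑ t → ∃[ R ] leaves t ↭ R ++ leaves u
split-⊑ ⊑-refl = [] , ↭-refl
split-⊑ (⊑-child c∈cs u⊑c) =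
  let R₁ , cs↭R₁++c = split-child c∈cs
      R₂ , c↭R₂++u  = split-⊑ u⊑c
  in R₁ ++ R₂ , ↭-trans cs↭R₁++c (↭-trans (++⁺ˡ R₁ c↭R₂++u) (↭-reflexive (≡.sym (++-assoc R₁ R₂ _))))

IsModule : ∀ {n} → Graph n → List (Fin n) → Set
IsModule G X = ∀ {w x x'} → w ∉ X → x ∈ X → x' ∈ X → adj G w x ≡ adj G w x'

clade-isModule : ∀ {n} {G : Graph n} {T u} → IsCotree G T → u ⊑ T → IsModule G (leaves u)
clade-isModule {n} {G} {T} {u} (T↭V , adj⇔Lca) u⊑T {w} w∉u x∈u x'∈u =
  ⇔→≡ (mk⇔ (λ wx → from (adj⇔Lca _ _ (apart x'∈u)) (Lca-clade u⊑T T! w∉u x∈u x'∈u (to (adj⇔Lca _ _ (apart x∈u)) wx)))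
           (λ wx' → from (adj⇔Lca _ _ (apart x∈u)) (Lca-clade u⊑T T! w∉u x'∈u x∈u (to (adj⇔Lca _ _ (apart x'∈u)) wx'))))
  where
  open Equivalence
  T! : Unique (leaves T)
  T! = Unique-↭ (↭-sym T↭V) (allFin⁺ n)
  apart : ∀ {y} → y ∈ leaves u → w ≢ y
  apart y∈u refl = w∉u y∈u

costTo : ∀ {n} → Graph n → Labelling n → Fin n → List (Fin n) → ℕ
costTo G h w X = sum (map (bad G h w) X)

costBetween : ∀ {n} → Graph n → Labelling n → List (Fin n) → List (Fin n) → ℕ
costBetween G h R X = sum (map (λ w → costTo G h w X) R)

bad-cong : ∀ {n} (G : Graph n) {h h' : Labelling n} {u v u' v'} → adj G u v ≡ adj G u' v' →
           (h u ≡ h v ⇔ h' u' ≡ h' v') → bad G h u v ≡ bad G h' u' v'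
bad-cong G {h} {h'} {u} {v} {u'} {v'} adj≡ same⇔
  rewrite adj≡ | does-⇔ same⇔ (h u ≟ h v) (h' u' ≟ h' v') = refl

bad-sym : ∀ {n} (G : Graph n) h u v → bad G h u v ≡ bad G h v u
bad-sym G h u v = bad-cong G {h} {h} (Graph.sym G u v) (mk⇔ ≡.sym ≡.sym)

cost-↭ : ∀ {n} (G : Graph n) h {xs ys} → xs ↭ ys → cost G xs h ≡ cost G ys h
cost-↭ G h refl        = refl
cost-↭ G h (prep x p)  = cong₂ _+_ (sum-↭ (map⁺ (bad G h x) p)) (cost-↭ G h p)
cost-↭ G h (trans p q) = ≡.trans (cost-↭ G h p) (cost-↭ G h q)
cost-↭ G h (swap {xs} {ys} x y p) = begin
  (bad G h x y + costTo G h x xs) + (costTo G h y xs + cost G xs h)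
    ≡⟨ cong₂ _+_ (cong₂ _+_ (bad-sym G h x y) (sum-↭ (map⁺ (bad G h x) p)))
                 (cong₂ _+_ (sum-↭ (map⁺ (bad G h y) p)) (cost-↭ G h p)) ⟩
  (bad G h y x + costTo G h x ys) + (costTo G h y ys + cost G ys h)
    ≡⟨ interchange (bad G h y x) _ _ _ ⟩
  (bad G h y x + costTo G h y ys) + (costTo G h x ys + cost G ys h) ∎
  where open ≡-Reasoning

cost-++ : ∀ {n} (G : Graph n) h R X → cost G (R ++ X) h ≡ cost G R h + cost G X h + costBetween G h R X
cost-++ G h [] X = ≡.sym (+-identityʳ (cost G X h))
cost-++ G h (w ∷ R) X = begin
  costTo G h w (R ++ X) + cost G (R ++ X) h
    ≡⟨ cong₂ _+_ (≡.trans (cong sum (map-++ (bad G h w) R X)) (sum-++ (map (bad G h w) R) _)) (cost-++ G h R X) ⟩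
  (costTo G h w R + costTo G h w X) + (cost G R h + cost G X h + costBetween G h R X)
    ≡⟨ regroup (costTo G h w R) _ _ _ _ ⟩
  (costTo G h w R + cost G R h) + cost G X h + (costTo G h w X + costBetween G h R X) ∎
  where
  open ≡-Reasoning
  regroup : ∀ a b c d e → (a + b) + (c + d + e) ≡ (a + c) + d + (b + e)
  regroup = solve-∀

cost-relabel : ∀ {n} (G : Graph n) {h h' : Labelling n} {ψ : ℕ → ℕ} → Injective _≡_ _≡_ ψ →
               ∀ L → (∀ {v} → v ∈ L → h' v ≡ ψ (h v)) → cost G L h' ≡ cost G L h
cost-relabel G ψ-inj [] _ = refl
cost-relabel G {h} {h'} {ψ} ψ-inj (x ∷ L) h'≡ψh = cong₂ _+_
  (cong sum (map-cong-local (All.tabulate λ v∈L → bad-cong G refl (same⇔ (here refl) (there v∈L)))))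
  (cost-relabel G ψ-inj L (h'≡ψh ∘ there))
  where
  same⇔ : ∀ {u v} → u ∈ x ∷ L → v ∈ x ∷ L → h' u ≡ h' v ⇔ h u ≡ h v
  same⇔ u∈ v∈ = mk⇔ (λ e → ψ-inj (≡.trans (≡.sym (h'≡ψh u∈)) (≡.trans e (h'≡ψh v∈))))
                    (λ e → ≡.trans (h'≡ψh u∈) (≡.trans (cong ψ e) (≡.sym (h'≡ψh v∈))))

-- clusterSize tests h x ≟ h w while bad tests h w ≟ h x; the rewrite aligns the two before splitting.
costTo-adjacent : ∀ {n} (G : Graph n) h w X → All (λ x → adj G w x ≡ true) X →
                  costTo G h w X + clusterSize X h (h w) ≡ length X
costTo-adjacent G h w [] [] = refl
costTo-adjacent G h w (x ∷ X) (wx ∷ wX)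
  rewrite wx | does-⇔ (mk⇔ ≡.sym ≡.sym) (h x ≟ h w) (h w ≟ h x)
  with does (h w ≟ h x)
... | true  = ≡.trans (+-suc _ _) (cong suc (costTo-adjacent G h w X wX))
... | false = cong suc (costTo-adjacent G h w X wX)

costTo-nonadjacent : ∀ {n} (G : Graph n) h w X → All (λ x → adj G w x ≡ false) X →
                     costTo G h w X ≡ clusterSize X h (h w)
costTo-nonadjacent G h w [] [] = refl
costTo-nonadjacent G h w (x ∷ X) (wx ∷ wX)
  rewrite wx | does-⇔ (mk⇔ ≡.sym ≡.sym) (h x ≟ h w) (h w ≟ h x)
  with does (h w ≟ h x)
... | true  = cong suc (costTo-nonadjacent G h w X wX)
... | false = costTo-nonadjacent G h w X wX

clusterSize-cong : ∀ {n} {X : List (Fin n)} {h h' c c'} → (∀ {x} → x ∈ X → h x ≡ c ⇔ h' x ≡ c') →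
                   clusterSize X h c ≡ clusterSize X h' c'
clusterSize-cong {X = X} {h} {h'} {c} {c'} = length-filter-cong (λ v → h v ≟ c) (λ v → h' v ≟ c') X

clusterSize-empty : ∀ {n} {X : List (Fin n)} {h c} → (∀ {x} → x ∈ X → h x ≢ c) → clusterSize X h c ≡ 0
clusterSize-empty {X = X} {h} {c} h≢c = cong length (filter-none (λ v → h v ≟ c) (All.tabulate h≢c))

clusterSize≤max : ∀ {n} (X : List (Fin n)) h c → clusterSize X h c ≤ maxClusterSize X h
clusterSize≤max X h c with any? (λ x → h x ≟ c) X
... | yes some = let x , x∈X , hx≡c = find some in
  subst (λ c → clusterSize X h c ≤ maxClusterSize X h) hx≡c (≤-foldr-⊔ (∈-map⁺ _ x∈X))
... | no none = subst (_≤ maxClusterSize X h) (≡.sym (clusterSize-empty (λ x∈X hx≡c → none (lose x∈X hx≡c)))) z≤n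

max-attained : ∀ {n} (X : List (Fin n)) h → ∃[ c ] maxClusterSize X h ≤ clusterSize X h c
max-attained X h with foldr-selective ⊔-sel 0 (map (λ v → clusterSize X h (h v)) X)
... | inj₁ max≡0 = 0 , subst (_≤ clusterSize X h 0) (≡.sym max≡0) z≤n
... | inj₂ max∈  = let x , _ , max≡ = ∈-map⁻ _ max∈ in h x , ≤-reflexive max≡

grown-cluster : ∀ {n} {X : List (Fin n)} {f : Labelling n} → SingleGrowth X f →
                ∃[ c ] (∀ {w x} → w ∉ X → x ∈ X → f w ≡ f x → f w ≡ c)
grown-cluster {n} {X} {f} single with any? (λ w → ¬? (w ∈? X) ×-dec any? (λ x → f w ≟ f x) X) (allFin n)
... | yes some =
  let w₀ , _ , w₀∉X , meets = find some
      x₀ , x₀∈X , fw₀≡fx₀   = find meets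
  in f w₀ , λ {w} {x} w∉X x∈X fw≡fx →
       single (f w) (f w₀) ((x , x∈X , ≡.sym fw≡fx) , (w , w∉X , refl))
                           ((x₀ , x₀∈X , ≡.sym fw₀≡fx₀) , (w₀ , w₀∉X , refl))
... | no none = 0 , λ {w} w∉X x∈X fw≡fx → contradiction (lose (∈-allFin w) (w∉X , lose x∈X fw≡fx)) none

-- Gluing two clusterings along a module

module Gluing
  {n} (G : Graph n) {R X : List (Fin n)} (V↭R++X : allFin n ↭ R ++ X) (X-module : IsModule G X)
  {x₀ : Fin n} (x₀∈X : x₀ ∈ X)
  {f : Labelling n} (f-optimal : Optimal G f)
  {c₀ : ℕ} (c₀-grown : ∀ {w x} → w ∉ X → x ∈ X → f w ≡ f x → f w ≡ c₀)
  (g : Labelling n) {ℓ : ℕ} (s≤k : clusterSize X f c₀ ≤ clusterSize X g ℓ)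
  where

  R∩X=∅ : ∀ {w} → w ∈ R → w ∉ X
  R∩X=∅ w∈R w∈X = proj₂ (proj₂ (Unique-++⁻ R (Unique-↭ V↭R++X (allFin⁺ n)))) (w∈R , w∈X)

  s k : ℕ
  s = clusterSize X f c₀
  k = clusterSize X g ℓ

  inC₀ : Fin n → ℕ
  inC₀ w = if does (f w ≟ c₀) then 1 else 0

  inC₀-yes : ∀ {w} → f w ≡ c₀ → inC₀ w ≡ 1
  inC₀-yes {w} fw≡c₀ rewrite dec-true (f w ≟ c₀) fw≡c₀ = refl

  inC₀-no : ∀ {w} → f w ≢ c₀ → inC₀ w ≡ 0
  inC₀-no {w} fw≢c₀ rewrite dec-false (f w ≟ c₀) fw≢c₀ = refl

  -- The crossing cost of w ∉ X is |X| − m or m, where m = |X ∩ cluster of w|, according as w sees X or not.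
  α β Q : Fin n → ℕ
  α w = if adj G w x₀ then inC₀ w else 0
  β w = if adj G w x₀ then 0 else inC₀ w
  Q w = if adj G w x₀ then length X else 0

  costTo-affine : ∀ h m {w} → w ∉ X → clusterSize X h (h w) ≡ m * inC₀ w →
                  costTo G h w X + m * α w ≡ Q w + m * β w
  costTo-affine h m {w} w∉X together = by-adjacency (adj G w x₀) (All.tabulate (λ x∈X → X-module w∉X x∈X x₀∈X))
    where
    open ≡-Reasoning
    by-adjacency : ∀ a → All (λ x → adj G w x ≡ a) X →
                   costTo G h w X + m * (if a then inC₀ w else 0) ≡ (if a then length X else 0) + m * (if a then 0 else inC₀ w)
    by-adjacency true adjacent = begin
      costTo G h w X + m * inC₀ w           ≡⟨ cong (costTo G h w X +_) together ⟨
      costTo G h w X + clusterSize X h (h w) ≡⟨ costTo-adjacent G h w X adjacent ⟩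
      length X                              ≡⟨ +-identityʳ _ ⟨
      length X + 0                          ≡⟨ cong (length X +_) (*-zeroʳ m) ⟨
      length X + m * 0                      ∎
    by-adjacency false nonadjacent = begin
      costTo G h w X + m * 0 ≡⟨ cong (costTo G h w X +_) (*-zeroʳ m) ⟩
      costTo G h w X + 0     ≡⟨ +-identityʳ _ ⟩
      costTo G h w X         ≡⟨ costTo-nonadjacent G h w X nonadjacent ⟩
      clusterSize X h (h w)  ≡⟨ together ⟩
      m * inC₀ w             ∎

  costBetween-affine : ∀ h m → (∀ {w} → w ∉ X → clusterSize X h (h w) ≡ m * inC₀ w) →
                       costBetween G h R X + m * sum (map α R) ≡ sum (map Q R) + m * sum (map β R)
  costBetween-affine h m together =
    sum-affine (λ w → costTo G h w X) α Q β m R (λ w∈R → costTo-affine h m (R∩X=∅ w∈R) (together (R∩X=∅ w∈R)))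

  f-together : ∀ {w} → w ∉ X → clusterSize X f (f w) ≡ s * inC₀ w
  f-together {w} w∉X with f w ≟ c₀
  ... | yes fw≡c₀ = begin
    clusterSize X f (f w)  ≡⟨ cong (clusterSize X f) fw≡c₀ ⟩
    s                      ≡⟨ *-identityʳ s ⟨
    s * 1                  ≡⟨ cong (s *_) (inC₀-yes fw≡c₀) ⟨
    s * inC₀ w             ∎
    where open ≡-Reasoning
  ... | no fw≢c₀ = ≡.trans (clusterSize-empty (λ x∈X fx≡fw → fw≢c₀ (c₀-grown w∉X x∈X (≡.sym fx≡fw))))
                           (≡.sym (≡.trans (cong (s *_) (inC₀-no fw≢c₀)) (*-zeroʳ s)))

  -- Labels outside X are even; φ encodes the clusters of g inside X, normally by odd labels.
  glue : (ℕ → ℕ) → Labelling n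
  glue φ v = if does (v ∈? X) then φ (g v) else 2 * f v

  glue-inside : ∀ {φ v} → v ∈ X → glue φ v ≡ φ (g v)
  glue-inside {φ} {v} v∈X with v ∈? X
  ... | yes _   = refl
  ... | no v∉X = contradiction v∈X v∉X

  glue-outside : ∀ {φ v} → v ∉ X → glue φ v ≡ 2 * f v
  glue-outside {φ} {v} v∉X with v ∈? X
  ... | yes v∈X = contradiction v∈X v∉X
  ... | no _    = refl

  cost-split : ∀ h → cost G (allFin n) h ≡ cost G R h + cost G X h + costBetween G h R X
  cost-split h = ≡.trans (cost-↭ G h V↭R++X) (cost-++ G h R X)

  cost-glue : ∀ {φ} → Injective _≡_ _≡_ φ →
              cost G (allFin n) (glue φ) ≡ cost G R f + cost G X g + costBetween G (glue φ) R X
  cost-glue {φ} φ-inj = ≡.trans (cost-split (glue φ)) (cong (_+ costBetween G (glue φ) R X) (cong₂ _+_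
    (cost-relabel G (*-cancelˡ-≡ _ _ 2) R (glue-outside {φ} ∘ R∩X=∅))
    (cost-relabel G φ-inj X (glue-inside {φ}))))

  glue-meets : ∀ {φ x w} → x ∈ X → w ∉ X → glue φ x ≡ glue φ w → φ (g x) ≡ 2 * f w
  glue-meets {φ} x∈X w∉X glued≡ = ≡.trans (≡.sym (glue-inside {φ} x∈X)) (≡.trans glued≡ (glue-outside {φ} w∉X))

  separate : ℕ → ℕ
  separate a = suc (2 * a)

  separate-injective : Injective _≡_ _≡_ separate
  separate-injective = *-cancelˡ-≡ _ _ 2 ∘ suc-injective

  separate-together : ∀ {w} → w ∉ X → clusterSize X (glue separate) (glue separate w) ≡ 0 * inC₀ w
  separate-together {w} w∉X = clusterSize-empty {h = glue separate} λ {x} x∈X glued≡ →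
    even≢odd (f w) (g x) (≡.sym (glue-meets {separate} x∈X w∉X glued≡))

  merge : ℕ → ℕ
  merge a = if does (a ≟ ℓ) then 2 * c₀ else suc (2 * a)

  merge-ℓ : merge ℓ ≡ 2 * c₀
  merge-ℓ rewrite dec-true (ℓ ≟ ℓ) refl = refl

  merge-other : ∀ {a} → a ≢ ℓ → merge a ≡ suc (2 * a)
  merge-other {a} a≢ℓ rewrite dec-false (a ≟ ℓ) a≢ℓ = refl

  merge-injective : Injective _≡_ _≡_ merge
  merge-injective {a} {b} eq with a ≟ ℓ | b ≟ ℓ
  ... | yes refl | yes refl = refl
  ... | yes refl | no b≢ℓ  = contradiction (≡.trans (≡.sym merge-ℓ) (≡.trans eq (merge-other b≢ℓ))) (even≢odd c₀ b)
  ... | no a≢ℓ  | yes refl = contradiction (≡.trans (≡.sym merge-ℓ) (≡.trans (≡.sym eq) (merge-other a≢ℓ))) (even≢odd c₀ a)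
  ... | no a≢ℓ  | no b≢ℓ  =
    separate-injective (≡.trans (≡.sym (merge-other a≢ℓ)) (≡.trans eq (merge-other b≢ℓ)))

  merge-meets : ∀ {a b} → merge a ≡ 2 * b → a ≡ ℓ × b ≡ c₀
  merge-meets {a} {b} eq with a ≟ ℓ
  ... | yes refl = refl , *-cancelˡ-≡ _ _ 2 (≡.trans (≡.sym eq) merge-ℓ)
  ... | no a≢ℓ  = contradiction (≡.trans (≡.sym eq) (merge-other a≢ℓ)) (even≢odd b a)

  merge-together : ∀ {w} → w ∉ X → clusterSize X (glue merge) (glue merge w) ≡ k * inC₀ w
  merge-together {w} w∉X with f w ≟ c₀
  ... | yes fw≡c₀ = begin
    clusterSize X (glue merge) (glue merge w) ≡⟨ clusterSize-cong {h = glue merge} {g} (λ {x} x∈X → mk⇔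
                                                    (λ glued≡ → proj₁ (merge-meets {g x} {f w} (glue-meets {merge} x∈X w∉X glued≡)))
                                                    (λ gx≡ℓ → joins x∈X gx≡ℓ)) ⟩
    k                                         ≡⟨ *-identityʳ k ⟨
    k * 1                                     ≡⟨ cong (k *_) (inC₀-yes fw≡c₀) ⟨
    k * inC₀ w                                ∎
    where
    open ≡-Reasoning
    joins : ∀ {x} → x ∈ X → g x ≡ ℓ → glue merge x ≡ glue merge w
    joins {x} x∈X gx≡ℓ = begin
      glue merge x  ≡⟨ glue-inside {merge} x∈X ⟩
      merge (g x)   ≡⟨ cong merge gx≡ℓ ⟩
      merge ℓ       ≡⟨ merge-ℓ ⟩
      2 * c₀        ≡⟨ cong (2 *_) fw≡c₀ ⟨
      2 * f w       ≡⟨ glue-outside {merge} w∉X ⟨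
      glue merge w  ∎
  ... | no fw≢c₀ = begin
    clusterSize X (glue merge) (glue merge w) ≡⟨ clusterSize-empty {h = glue merge} (λ {x} x∈X glued≡ →
                                                    fw≢c₀ (proj₂ (merge-meets {g x} (glue-meets {merge} x∈X w∉X glued≡)))) ⟩
    0                                         ≡⟨ *-zeroʳ k ⟨
    k * 0                                     ≡⟨ cong (k *_) (inC₀-no fw≢c₀) ⟨
    k * inC₀ w                                ∎
    where open ≡-Reasoning

  cheaper-crossing⇒restriction-optimal : ∀ {φ} → Injective _≡_ _≡_ φ → costBetween G (glue φ) R X ≤ costBetween G f R X →
                  cost G X f ≤ cost G X g
  cheaper-crossing⇒restriction-optimal {φ} φ-inj glue≤f = +-cancelˡ-≤ (cost G R f) _ _ (+-cancelʳ-≤ (costBetween G f R X) _ _ (begin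
    cost G R f + cost G X f + costBetween G f R X        ≡⟨ cost-split f ⟨
    cost G (allFin n) f                                 ≤⟨ f-optimal (glue φ) ⟩
    cost G (allFin n) (glue φ)                          ≡⟨ cost-glue φ-inj ⟩
    cost G R f + cost G X g + costBetween G (glue φ) R X ≤⟨ +-monoʳ-≤ _ glue≤f ⟩
    cost G R f + cost G X g + costBetween G f R X        ∎))
    where open ≤-Reasoning

  separate-costBetween : costBetween G (glue separate) R X ≡ sum (map Q R)
  separate-costBetween = ≡.trans (≡.sym (+-identityʳ _))
    (≡.trans (costBetween-affine (glue separate) 0 separate-together) (+-identityʳ _))

  restriction-optimal : cost G X f ≤ cost G X g
  restriction-optimal with affine-min separate-costBetween (costBetween-affine f s f-together)
                             (costBetween-affine (glue merge) k merge-together) s≤k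
  ... | inj₁ merge≤f    = cheaper-crossing⇒restriction-optimal merge-injective merge≤f
  ... | inj₂ separate≤f = cheaper-crossing⇒restriction-optimal separate-injective separate≤f

module-restriction-optimal : ∀ {n} (G : Graph n) {R X : List (Fin n)} → allFin n ↭ R ++ X → IsModule G X →
                             ∀ {f} → Optimal G f → SingleGrowth X f →
                             ∀ g → maxClusterSize X f ≤ maxClusterSize X g → cost G X f ≤ cost G X g
module-restriction-optimal G {X = []} _ _ _ _ _ _ = z≤n
module-restriction-optimal G {X = x₀ ∷ X} V↭R++X X-module {f} f-optimal single g max≤max =
  let c₀ , c₀-grown = grown-cluster single
      ℓ , max≤ℓ     = max-attained (x₀ ∷ X) g
      s≤k           = ≤-trans (clusterSize≤max (x₀ ∷ X) f c₀) (≤-trans max≤max max≤ℓ)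
  in Gluing.restriction-optimal G V↭R++X X-module (here refl) f-optimal c₀-grown g s≤k

corollary3 : ∀ {n} (G : Graph n) (T : Cotree n) → IsCotree G T →
    OneNodesHaveOneNonLeafChild T →
    (f : Labelling n) → WellBehaved G T f →
    (u : Cotree n) → u ⊑ T →
    ∀ (g : Labelling n) → maxClusterSize (leaves u) g ≡ maxClusterSize (leaves u) f →
    cost G (leaves u) f ≤ cost G (leaves u) g
corollary3 G T T-cotree _ f (f-optimal , single-growth , _) u u⊑T g max≡max =
  let R , T↭R++u = split-⊑ u⊑T
  in module-restriction-optimal G (↭-trans (↭-sym (proj₁ T-cotree)) T↭R++u) (clade-isModule {G = G} T-cotree u⊑T)
       f-optimal (single-growth u u⊑T) g (≤-reflexive (≡.sym max≡max))
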